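{- Let $1\le i<n$ and let $a$ be a weak composition with $a_j=0$ for all $j\neq i,i+1$ and $a_i>a_{i+1}$. Then for every $T\in\mathrm{SSKD}(a)$ we have $\mathcal{E}_i(T)\in\mathrm{SSKD}(s_i\cdot a)$, where $s_i\cdot a$ is obtained from $a$ by exchanging $a_i$ and $a_{i+1}$.
   Context: Fix $n\ge 2$. A weak composition is $a=(a_1,\ldots,a_n)\in\mathbb{Z}_{\ge0}^n$. Its diagram has $a_r$ cells left-justified in row $r$ (row $1$ at the bottom), in columns $1,\dots,a_r$; there is also a basement column $0$ whose cell in row $r$ has entry $r$. A filling assigns an entry in $\{1,\ldots,n\}$ to each cell. A filling is non-attacking if no two cells with the same entry lie in the same column, and no two cells with the same entry lie in adjacent columns $c,c+1$ with the cell in column $c$ in a strictly higher row. A triple consists of three cells (basement allowed): two cells in row $r$ in adjacent columns $c,c+1$, and a third cell either (Type I) in column $c$ in a row $s>r$ with $a_r>a_s$, or (Type II) in column $c+1$ in a row $s<r$ with $a_r\ge a_s$ (row lengths taken in the shape of the filling). Entries are compared as integers (basement entry = row index), equal entries being compared by regarding the one further right as smaller. For Type I let $\alpha,\beta,\gamma$ be the entries of the lower-left, lower-right, upper cell; for Type II of the upper-left, upper-right, lower cell. It is a co-inversion triple if $\alpha<\beta<\gamma$ or $\beta<\gamma<\alpha$ or $\gamma<\alpha<\beta$. $\mathrm{SSKD}(a)$ is the set of non-attacking fillings of the diagram of $a$ with no co-inversion triples. Embedding map $\mathcal{E}_i$ ($1\le i<n$), defined when $a_i>a_{i+1}$: for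 $T\in\mathrm{SSKD}(a)$, $\mathcal{E}_i(T)$ is a filling of the diagram of $s_i\cdot a$. For $k=0,\ldots,a_{i+1}$ let $y_k,x_k$ be the entries of $T$ in rows $i+1,i$ of column $k$ (column $0$ is the basement, so $y_0=i+1$, $x_0=i$, and these stay in place in $\mathcal{E}_i(T)$). Inductively for $k=0,\ldots,a_{i+1}-1$, the cells in rows $i,i+1$ of column $k+1$ of $\mathcal{E}_i(T)$ receive $x_{k+1},y_{k+1}$ as follows: if in column $k$ of $\mathcal{E}_i(T)$ the entry $y_k$ is above $x_k$, put $y_{k+1}$ in row $i+1$ and $x_{k+1}$ in row $i$, unless this makes the cells with entries $y_k$ (row $i+1$, column $k$), $y_{k+1}$ (row $i+1$, column $k+1$), $x_{k+1}$ (row $i$, column $k+1$) a Type II co-inversion triple, in which case put $x_{k+1}$ in row $i+1$ and $y_{k+1}$ in row $i$; otherwise $x_k$ is above $y_k$, and put $x_{k+1}$ in row $i+1$ and $y_{k+1}$ in row $i$, unless this makes $x_k,x_{k+1},y_{k+1}$ a Type II co-inversion triple, in which case put $y_{k+1}$ in row $i+1$ and $x_{k+1}$ in row $i$. The entries of row $i$ of $T$ in columns $a_{i+1}+1,\ldots,a_i$ are placed in the same columns of row $i+1$ of $\mathcal{E}_i(T)$, and all other rows are copied from $T$. -}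

module Defs where

open import Data.Nat using (ℕ; zero; suc; _≤_; _<_; _≤?_; _<?_; _≟_)
open import Data.Bool using (Bool; true; false; not; if_then_else_)
open import Data.Product using (_×_; _,_)
open import Data.Sum using (_⊎_)
open import Relation.Nullary using (Dec; does; ¬_)
open import Relation.Nullary.Decidable using (_×-dec_; _⊎-dec_)
open import Relation.Binary.PropositionalEquality using (_≡_; _≢_)

-- A weak composition (a_1,...,a_n): only the values a 1, ..., a n are used.
Composition : Set
Composition = ℕ → ℕ

-- A filling: T r c is the entry in row r, column c (c ≥ 1); values outside
-- the diagram are irrelevant.
Filling : Set
Filling = ℕ → ℕ → ℕ

-- entry of a cell, with the basement column 0 holding the row index
val : Filling → ℕ → ℕ → ℕ
val T r zero    = r
val T r (suc c) = T r (suc c)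

InDiag : ℕ → Composition → ℕ → ℕ → Set
InDiag n a r c = (1 ≤ r) × (r ≤ n) × (c ≤ a r)

-- a labelled entry: (value , column)
-- strict comparison: as integers, equal values compared by regarding the
-- one further right as smaller
_≺_ : ℕ × ℕ → ℕ × ℕ → Set
(v , c) ≺ (w , d) = (v < w) ⊎ ((v ≡ w) × (d < c))

_≺?_ : (p q : ℕ × ℕ) → Dec (p ≺ q)
(v , c) ≺? (w , d) = (v <? w) ⊎-dec ((v ≟ w) ×-dec (d <? c))

CoInv : ℕ × ℕ → ℕ × ℕ → ℕ × ℕ → Set
CoInv α β γ = ((α ≺ β) × (β ≺ γ)) ⊎ ((β ≺ γ) × (γ ≺ α)) ⊎ ((γ ≺ α) × (α ≺ β))

coinv? : (α β γ : ℕ × ℕ) → Dec (CoInv α β γ)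
coinv? α β γ = ((α ≺? β) ×-dec (β ≺? γ)) ⊎-dec ((β ≺? γ) ×-dec (γ ≺? α))
               ⊎-dec ((γ ≺? α) ×-dec (α ≺? β))

NonAttacking : ℕ → Composition → Filling → Set
NonAttacking n a T =
  (∀ r s c → InDiag n a r c → InDiag n a s c → r ≢ s → val T r c ≢ val T s c)
  × (∀ r s c → InDiag n a r c → InDiag n a s (suc c) → s < r
       → val T r c ≢ val T s (suc c))

TypeI : ℕ → Composition → ℕ → ℕ → ℕ → Set
TypeI n a r s c = InDiag n a r c × InDiag n a r (suc c) × InDiag n a s c
                  × (r < s) × (a s < a r)

TypeII : ℕ → Composition → ℕ → ℕ → ℕ → Set
TypeII n a r s c = InDiag n a r c × InDiag n a r (suc c) × InDiag n a s (suc c)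
                   × (s < r) × (a s ≤ a r)

SSKD : ℕ → Composition → Filling → Set
SSKD n a T =
  (∀ r c → InDiag n a r (suc c) → (1 ≤ T r (suc c)) × (T r (suc c) ≤ n))
  × NonAttacking n a T
  × (∀ r s c → TypeI n a r s c →
       ¬ CoInv (val T r c , c) (val T r (suc c) , suc c) (val T s c , c))
  × (∀ r s c → TypeII n a r s c →
       ¬ CoInv (val T r c , c) (val T r (suc c) , suc c) (val T s (suc c) , suc c))

swap : ℕ → Composition → Composition
swap i a j = if does (j ≟ i) then a (suc i)
             else (if does (j ≟ suc i) then a i else a j)

-- topY i T k = true  iff in column k of E_i(T) the entry y_k (from row i+1
-- of T) sits in row i+1 (and x_k in row i)
topY : ℕ → Filling → ℕ → Bool
topY i T zero = true
topY i T (suc k) with topY i T k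
... | true  = not (does (coinv? (val T (suc i) k , k) (val T (suc i) (suc k) , suc k)
                                (val T i (suc k) , suc k)))
... | false = does (coinv? (val T i k , k) (val T i (suc k) , suc k)
                           (val T (suc i) (suc k) , suc k))

embed : ℕ → Composition → Filling → Filling
embed i a T r c =
  if does (r ≟ suc i)
  then (if does (c ≤? a (suc i))
        then (if topY i T c then val T (suc i) c else val T i c)
        else T i c)
  else (if does (r ≟ i)
        then (if does (c ≤? a (suc i))
              then (if topY i T c then val T i c else val T (suc i) c)
              else T i c)
        else T r c)

module Submission where

-- Only rows i and i+1 of the diagram are non-empty, so the triples of the
-- diagram of s_i·a are the Type II triples inside rows i+1, i and the Type I
-- triples whose third cell is the basement cell of an empty row s.  The
-- embedding builds rows i+1, i column by column and flips the pair of entries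
-- of a column exactly when the straight placement would form a Type II
-- co-inversion with the upper cell of the previous column; as transposing the
-- last two entries of a co-inversion triple destroys it, no Type II
-- co-inversion arises, and the same choice keeps the rows non-attacking.  A
-- Type I triple on the basement reads r < v ≤ s for the column-1 entry v, and
-- this configuration is already excluded in T.

open import Defs
open import Data.Bool using (Bool; true; false; not; if_then_else_)
open import Data.Empty using (⊥-elim)
open import Data.Nat using (ℕ; zero; suc; _≤_; _<_; z≤n; s≤s; _≟_; _≤?_)
open import Data.Nat.Properties
open import Data.Product using (_×_; _,_; proj₁; proj₂)
open import Data.Sum using (inj₁; inj₂)
open import Relation.Binary.Definitions using (tri<; tri≈; tri>)
open import Relation.Binary.PropositionalEquality
open import Relation.Nullary using (Dec; yes; no; does; ¬_)
open import Relation.Nullary.Decidable using (dec-true; dec-false)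

if-dec-yes : ∀ {P : Set} {A : Set} {x y : A} (d : Dec P) → P → (if does d then x else y) ≡ x
if-dec-yes d p rewrite dec-true d p = refl

if-dec-no : ∀ {P : Set} {A : Set} {x y : A} (d : Dec P) → ¬ P → (if does d then x else y) ≡ y
if-dec-no d ¬p rewrite dec-false d ¬p = refl

if-dec-elim : ∀ {P : Set} {A : Set} (Q : A → Set) (d : Dec P) {x y : A}
              → (P → Q x) → (¬ P → Q y) → Q (if does d then x else y)
if-dec-elim Q (yes p) on-yes _     = on-yes p
if-dec-elim Q (no ¬p) _     on-no = on-no ¬p

if-elim : ∀ {A : Set} (P : A → Set) b {x y : A} → P x → P y → P (if b then x else y)
if-elim P true  px _  = px
if-elim P false _  py = py

≺-asym : ∀ {p q} → p ≺ q → ¬ q ≺ p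
≺-asym (inj₁ v<w)        (inj₁ w<v)        = <-asym v<w w<v
≺-asym (inj₁ v<w)        (inj₂ (refl , _)) = <-irrefl refl v<w
≺-asym (inj₂ (refl , _)) (inj₁ v<v)        = <-irrefl refl v<v
≺-asym (inj₂ (_ , d<c))  (inj₂ (_ , c<d))  = <-asym d<c c<d

¬≺-rightward : ∀ {v c} → ¬ (v , c) ≺ (v , suc c)
¬≺-rightward (inj₁ v<v)          = <-irrefl refl v<v
¬≺-rightward {c = c} (inj₂ (_ , c+1<c)) = <-asym c+1<c (n<1+n c)

¬coinv-transpose : ∀ {p q r} → CoInv p q r → ¬ CoInv p r q
¬coinv-transpose (inj₁ (_ , q≺r))        (inj₁ (_ , r≺q))        = ≺-asym q≺r r≺q
¬coinv-transpose (inj₁ (_ , q≺r))        (inj₂ (inj₁ (r≺q , _))) = ≺-asym q≺r r≺q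
¬coinv-transpose (inj₁ (p≺q , _))        (inj₂ (inj₂ (q≺p , _))) = ≺-asym p≺q q≺p
¬coinv-transpose (inj₂ (inj₁ (_ , r≺p))) (inj₁ (p≺r , _))        = ≺-asym r≺p p≺r
¬coinv-transpose (inj₂ (inj₁ (q≺r , _))) (inj₂ (inj₁ (r≺q , _))) = ≺-asym q≺r r≺q
¬coinv-transpose (inj₂ (inj₁ (_ , r≺p))) (inj₂ (inj₂ (_ , p≺r))) = ≺-asym r≺p p≺r
¬coinv-transpose (inj₂ (inj₂ (r≺p , _))) (inj₁ (p≺r , _))        = ≺-asym r≺p p≺r
¬coinv-transpose (inj₂ (inj₂ (_ , p≺q))) (inj₂ (inj₁ (_ , q≺p))) = ≺-asym p≺q q≺p
¬coinv-transpose (inj₂ (inj₂ (r≺p , _))) (inj₂ (inj₂ (_ , p≺r))) = ≺-asym r≺p p≺r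

¬coinv-repeated : ∀ v w c → ¬ CoInv (v , c) (v , suc c) (w , suc c)
¬coinv-repeated v w c (inj₁ (v≺v , _))                          = ¬≺-rightward v≺v
¬coinv-repeated v w c (inj₂ (inj₂ (_ , v≺v)))                   = ¬≺-rightward v≺v
¬coinv-repeated v w c (inj₂ (inj₁ (inj₁ v<w , inj₁ w<v)))       = <-asym v<w w<v
¬coinv-repeated v w c (inj₂ (inj₁ (inj₁ v<w , inj₂ (refl , _)))) = <-irrefl refl v<w
¬coinv-repeated v w c (inj₂ (inj₁ (inj₂ (_ , c<c) , _)))        = <-irrefl refl c<c

coinv-repeated : ∀ v w c → w ≢ v → CoInv (v , c) (w , suc c) (v , suc c)
coinv-repeated v w c w≢v with <-cmp w v
... | tri< w<v _ _   = inj₂ (inj₁ (inj₁ w<v , inj₂ (refl , n<1+n c)))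
... | tri≈ _ w≡v _   = ⊥-elim (w≢v w≡v)
... | tri> _ _ v<w   = inj₂ (inj₂ (inj₂ (refl , n<1+n c) , inj₁ v<w))

coinv⇒between : ∀ {r v s c} → r < s → CoInv (r , c) (v , suc c) (s , c) → r < v × v ≤ s
coinv⇒between r<s (inj₁ (inj₁ r<v , inj₁ v<s))        = r<v , <⇒≤ v<s
coinv⇒between r<s (inj₁ (inj₁ r<v , inj₂ (refl , _))) = r<v , ≤-refl
coinv⇒between {r} r<s (inj₁ (inj₂ (_ , c+1<c) , _))   = ⊥-elim (¬≺-rightward {v = r} (inj₂ (refl , c+1<c)))
coinv⇒between r<s (inj₂ (inj₁ (_ , s≺r)))             = ⊥-elim (≺-asym s≺r (inj₁ r<s))
coinv⇒between r<s (inj₂ (inj₂ (s≺r , _)))             = ⊥-elim (≺-asym s≺r (inj₁ r<s))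

between⇒coinv : ∀ {r v s c} → r < v → v ≤ s → CoInv (r , c) (v , suc c) (s , c)
between⇒coinv {c = c} r<v v≤s with m≤n⇒m<n∨m≡n v≤s
... | inj₁ v<s = inj₁ (inj₁ r<v , inj₁ v<s)
... | inj₂ v≡s = inj₁ (inj₁ r<v , inj₂ (v≡s , n<1+n c))

¬coinv-cong : ∀ {u u' v v' w w' c d e} → u ≡ u' → v ≡ v' → w ≡ w'
              → ¬ CoInv (u' , c) (v' , d) (w' , e) → ¬ CoInv (u , c) (v , d) (w , e)
¬coinv-cong refl refl refl ¬cv = ¬cv

stack : Bool → ℕ → ℕ → ℕ × ℕ
stack b y x = (if b then y else x) , (if b then x else y)

stack-if : ∀ b {y x : ℕ} → stack b y x ≡ (if b then (y , x) else (x , y))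
stack-if true  = refl
stack-if false = refl

stack-not : ∀ b {y x : ℕ} → stack (not b) y x ≡ (if b then (x , y) else (y , x))
stack-not true  = refl
stack-not false = refl

stack-≢ : ∀ b {y x : ℕ} → x ≢ y → proj₁ (stack b y x) ≢ proj₂ (stack b y x)
stack-≢ true  x≢y = ≢-sym x≢y
stack-≢ false x≢y = x≢y

orient : ℕ → ℕ → ℕ × ℕ → ℕ × ℕ
orient u c (p , q) = if does (coinv? (u , c) (p , suc c) (q , suc c)) then (q , p) else (p , q)

orient-¬coinv : ∀ u c pq
                → ¬ CoInv (u , c) (proj₁ (orient u c pq) , suc c) (proj₂ (orient u c pq) , suc c)
orient-¬coinv u c (p , q) =
  if-dec-elim (λ pq → ¬ CoInv (u , c) (proj₁ pq , suc c) (proj₂ pq , suc c))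
              (coinv? (u , c) (p , suc c) (q , suc c)) ¬coinv-transpose (λ ¬upq → ¬upq)

orient-≢ : ∀ u c pq → proj₁ pq ≢ proj₂ pq → u ≢ proj₂ (orient u c pq)
orient-≢ u c (p , q) p≢q =
  if-dec-elim (λ pq → u ≢ proj₂ pq) (coinv? (u , c) (p , suc c) (q , suc c))
              (λ { upq refl → ¬coinv-repeated u q c upq })
              (λ { ¬upq refl → ¬upq (coinv-repeated u p c p≢q) })

swap-at-i : ∀ i a → swap i a i ≡ a (suc i)
swap-at-i i a = if-dec-yes (i ≟ i) refl

swap-at-suc-i : ∀ i a → swap i a (suc i) ≡ a i
swap-at-suc-i i a = trans (if-dec-no (suc i ≟ i) 1+n≢n) (if-dec-yes (suc i ≟ suc i) refl)

swap-elsewhere : ∀ i a j → j ≢ i → j ≢ suc i → swap i a j ≡ a j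
swap-elsewhere i a j j≢i j≢i+1 = trans (if-dec-no (j ≟ i) j≢i) (if-dec-no (j ≟ suc i) j≢i+1)

module Embedding (i : ℕ) (a : Composition) (T : Filling) where

  X Y : ℕ → ℕ
  X = val T i
  Y = val T (suc i)

  m : ℕ
  m = a (suc i)

  b : Composition
  b = swap i a

  E : Filling
  E = embed i a T

  column : ℕ → ℕ × ℕ
  column c = stack (topY i T c) (Y c) (X c)

  upper lower : ℕ → ℕ
  upper c = proj₁ (column c)
  lower c = proj₂ (column c)

  column-suc : ∀ c → column (suc c) ≡ orient (upper c) c (stack (topY i T c) (Y (suc c)) (X (suc c)))
  column-suc c with topY i T c
  ... | true  = stack-not _
  ... | false = stack-if _

  upper≢lower : ∀ c → X c ≢ Y c → upper c ≢ lower c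
  upper≢lower c = stack-≢ (topY i T c)

  upper≢next-lower : ∀ c → X (suc c) ≢ Y (suc c) → upper c ≢ lower (suc c)
  upper≢next-lower c X≢Y =
    subst (λ col → upper c ≢ proj₂ col) (sym (column-suc c))
          (orient-≢ (upper c) c _ (stack-≢ (topY i T c) X≢Y))

  ¬coinv-upper-upper-lower : ∀ c → ¬ CoInv (upper c , c) (upper (suc c) , suc c) (lower (suc c) , suc c)
  ¬coinv-upper-upper-lower c =
    subst (λ col → ¬ CoInv (upper c , c) (proj₁ col , suc c) (proj₂ col , suc c)) (sym (column-suc c))
          (orient-¬coinv (upper c) c (stack (topY i T c) (Y (suc c)) (X (suc c))))

  E-upper : ∀ c → c ≤ m → val E (suc i) c ≡ upper c
  E-upper zero    _   = refl
  E-upper (suc c) c<m = trans (if-dec-yes (suc i ≟ suc i) refl) (if-dec-yes (suc c ≤? m) c<m)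

  E-lower : ∀ c → c ≤ m → val E i c ≡ lower c
  E-lower zero    _   = refl
  E-lower (suc c) c<m =
    trans (if-dec-no (i ≟ suc i) (≢-sym 1+n≢n))
          (trans (if-dec-yes (i ≟ i) refl) (if-dec-yes (suc c ≤? m) c<m))

  E-upper-beyond : ∀ c → m < suc c → val E (suc i) (suc c) ≡ X (suc c)
  E-upper-beyond c m<c = trans (if-dec-yes (suc i ≟ suc i) refl) (if-dec-no (suc c ≤? m) (<⇒≱ m<c))

  module Correctness (n : ℕ) (1≤i : 1 ≤ i) (i<n : i < n)
                     (others-empty : ∀ j → 1 ≤ j → j ≤ n → j ≢ i → j ≢ suc i → a j ≡ 0)
                     (m<ai : m < a i) (T-sskd : SSKD n a T) where

    cellᵢ : ∀ {c} → c ≤ a i → InDiag n a i c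
    cellᵢ c≤ai = 1≤i , <⇒≤ i<n , c≤ai

    cellₛ : ∀ {c} → c ≤ m → InDiag n a (suc i) c
    cellₛ c≤m = s≤s z≤n , i<n , c≤m

    basement-cell : ∀ {r} → suc i < r → r ≤ n → InDiag n a r 0
    basement-cell i+1<r r≤n = ≤-trans (s≤s z≤n) i+1<r , r≤n , z≤n

    m≤ai : m ≤ a i
    m≤ai = <⇒≤ m<ai

    data Row : ℕ → Set where
      row-i     : Row i
      row-suc-i : Row (suc i)
      empty-row : ∀ {r} → r ≢ i → r ≢ suc i → b r ≡ 0 → a r ≡ 0 → Row r

    rowOf : ∀ r → 1 ≤ r → r ≤ n → Row r
    rowOf r 1≤r r≤n with r ≟ i | r ≟ suc i
    ... | yes refl | _        = row-i
    ... | no _     | yes refl = row-suc-i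
    ... | no r≢i   | no r≢i+1 =
      let ar≡0 = others-empty r 1≤r r≤n r≢i r≢i+1
      in empty-row r≢i r≢i+1 (trans (swap-elsewhere i a r r≢i r≢i+1) ar≡0) ar≡0

    no-cell : ∀ {x c} → x ≡ 0 → ¬ c < x
    no-cell refl = n≮0

    basement-column : ∀ {x c} → x ≡ 0 → c ≤ x → c ≡ 0
    basement-column refl = n≤0⇒n≡0

    above-rows : ∀ {r} → i < r → r ≢ suc i → suc i < r
    above-rows i<r r≢i+1 = ≤∧≢⇒< i<r (≢-sym r≢i+1)

    X≢Y : ∀ c → c ≤ m → X c ≢ Y c
    X≢Y c c≤m =
      proj₁ (proj₁ (proj₂ T-sskd)) i (suc i) c (cellᵢ (≤-trans c≤m m≤ai)) (cellₛ c≤m) (≢-sym 1+n≢n)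

    data RowPairEntry (c : ℕ) : ℕ → Set where
      in-row-i     : c ≤ a i → RowPairEntry c (X c)
      in-row-suc-i : c ≤ m   → RowPairEntry c (Y c)

    upper-entry : ∀ c → c ≤ m → RowPairEntry c (upper c)
    upper-entry c c≤m = if-elim (RowPairEntry c) (topY i T c) (in-row-suc-i c≤m) (in-row-i (≤-trans c≤m m≤ai))

    lower-entry : ∀ c → c ≤ m → RowPairEntry c (lower c)
    lower-entry c c≤m = if-elim (RowPairEntry c) (topY i T c) (in-row-i (≤-trans c≤m m≤ai)) (in-row-suc-i c≤m)

    E-row-i-entry : ∀ c → c ≤ m → RowPairEntry c (val E i c)
    E-row-i-entry c c≤m = subst (RowPairEntry c) (sym (E-lower c c≤m)) (lower-entry c c≤m)

    E-row-suc-i-entry : ∀ c → c ≤ a i → RowPairEntry c (val E (suc i) c)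
    E-row-suc-i-entry zero    _      = in-row-suc-i z≤n
    E-row-suc-i-entry (suc c) c<ai with suc c ≤? m
    ... | yes c<m = subst (RowPairEntry (suc c)) (sym (E-upper (suc c) c<m)) (upper-entry (suc c) c<m)
    ... | no  c≮m = subst (RowPairEntry (suc c)) (sym (E-upper-beyond c (≰⇒> c≮m))) (in-row-i c<ai)

    entry-range : ∀ {c v} → RowPairEntry (suc c) v → 1 ≤ v × v ≤ n
    entry-range (in-row-i c<ai)    = proj₁ T-sskd i _ (cellᵢ c<ai)
    entry-range (in-row-suc-i c<m) = proj₁ T-sskd (suc i) _ (cellₛ c<m)

    basement-≢-entry : ∀ {r v} → suc i < r → r ≤ n → RowPairEntry 1 v → r ≢ v
    basement-≢-entry {r} i+1<r r≤n (in-row-i 1≤ai) =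
      proj₂ (proj₁ (proj₂ T-sskd)) r i 0 (basement-cell i+1<r r≤n) (cellᵢ 1≤ai)
            (<-trans (n<1+n i) i+1<r)
    basement-≢-entry {r} i+1<r r≤n (in-row-suc-i 1≤m) =
      proj₂ (proj₁ (proj₂ T-sskd)) r (suc i) 0 (basement-cell i+1<r r≤n) (cellₛ 1≤m) i+1<r

    entry-not-between : ∀ {s v} → suc i < s → s ≤ n → a s ≡ 0 → RowPairEntry 1 v
                        → ¬ (suc i < v × v ≤ s)
    entry-not-between {s} i+1<s s≤n as≡0 (in-row-i 1≤ai) (i+1<v , v≤s) =
      proj₁ (proj₂ (proj₂ T-sskd)) i s 0
            (cellᵢ z≤n , cellᵢ 1≤ai , basement-cell i+1<s s≤n
            , <-trans (n<1+n i) i+1<s , subst (_< a i) (sym as≡0) 1≤ai)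
            (between⇒coinv (<-trans (n<1+n i) i+1<v) v≤s)
    entry-not-between {s} i+1<s s≤n as≡0 (in-row-suc-i 1≤m) (i+1<v , v≤s) =
      proj₁ (proj₂ (proj₂ T-sskd)) (suc i) s 0
            (cellₛ z≤n , cellₛ 1≤m , basement-cell i+1<s s≤n
            , i+1<s , subst (_< m) (sym as≡0) 1≤m)
            (between⇒coinv i+1<v v≤s)

    E-rows-differ : ∀ c → c ≤ m → val E (suc i) c ≢ val E i c
    E-rows-differ c c≤m rewrite E-upper c c≤m | E-lower c c≤m = upper≢lower c (X≢Y c c≤m)

    E-diagonal-differ : ∀ c → suc c ≤ m → val E (suc i) c ≢ val E i (suc c)
    E-diagonal-differ c c<m rewrite E-upper c (<⇒≤ c<m) | E-lower (suc c) c<m =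
      upper≢next-lower c (X≢Y (suc c) c<m)

    E-range : ∀ r c → InDiag n b r (suc c) → (1 ≤ E r (suc c)) × (E r (suc c) ≤ n)
    E-range r c (1≤r , r≤n , c<br) with rowOf r 1≤r r≤n
    ... | row-i              = entry-range (E-row-i-entry (suc c) (subst (_ ≤_) (swap-at-i i a) c<br))
    ... | row-suc-i          = entry-range (E-row-suc-i-entry (suc c) (subst (_ ≤_) (swap-at-suc-i i a) c<br))
    ... | empty-row _ _ br≡0 _ = ⊥-elim (no-cell br≡0 c<br)

    E-column-distinct : ∀ r s c → InDiag n b r c → InDiag n b s c → r ≢ s → val E r c ≢ val E s c
    E-column-distinct r s zero    _ _ r≢s = r≢s
    E-column-distinct r s (suc c) (1≤r , r≤n , c<br) (1≤s , s≤n , c<bs) r≢s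
      with rowOf r 1≤r r≤n | rowOf s 1≤s s≤n
    ... | empty-row _ _ br≡0 _ | _                    = ⊥-elim (no-cell br≡0 c<br)
    ... | _                    | empty-row _ _ bs≡0 _ = ⊥-elim (no-cell bs≡0 c<bs)
    ... | row-i     | row-i     = ⊥-elim (r≢s refl)
    ... | row-suc-i | row-suc-i = ⊥-elim (r≢s refl)
    ... | row-i     | row-suc-i = ≢-sym (E-rows-differ (suc c) (subst (_ ≤_) (swap-at-i i a) c<br))
    ... | row-suc-i | row-i     = E-rows-differ (suc c) (subst (_ ≤_) (swap-at-i i a) c<bs)

    E-adjacent-distinct : ∀ r s c → InDiag n b r c → InDiag n b s (suc c) → s < r
                          → val E r c ≢ val E s (suc c)
    E-adjacent-distinct r s c (1≤r , r≤n , c≤br) (1≤s , s≤n , c<bs) s<r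
      with rowOf r 1≤r r≤n | rowOf s 1≤s s≤n
    ... | _         | empty-row _ _ bs≡0 _ = ⊥-elim (no-cell bs≡0 c<bs)
    ... | row-i     | row-i     = ⊥-elim (<-irrefl refl s<r)
    ... | row-i     | row-suc-i = ⊥-elim (<-asym s<r (n<1+n i))
    ... | row-suc-i | row-suc-i = ⊥-elim (<-irrefl refl s<r)
    ... | row-suc-i | row-i     = E-diagonal-differ c (subst (_ ≤_) (swap-at-i i a) c<bs)
    ... | empty-row _ r≢i+1 br≡0 _ | row-i with refl ← basement-column br≡0 c≤br =
      basement-≢-entry (above-rows s<r r≢i+1) r≤n (E-row-i-entry 1 (subst (_ ≤_) (swap-at-i i a) c<bs))
    ... | empty-row _ _ br≡0 _ | row-suc-i with refl ← basement-column br≡0 c≤br =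
      basement-≢-entry s<r r≤n (E-row-suc-i-entry 1 (subst (_ ≤_) (swap-at-suc-i i a) c<bs))

    E-no-typeI : ∀ r s c → TypeI n b r s c
                 → ¬ CoInv (val E r c , c) (val E r (suc c) , suc c) (val E s c , c)
    E-no-typeI r s c (_ , (1≤r , r≤n , c<br) , (1≤s , s≤n , c≤bs) , r<s , bs<br)
      with rowOf r 1≤r r≤n | rowOf s 1≤s s≤n
    ... | empty-row _ _ br≡0 _ | _ = ⊥-elim (no-cell br≡0 c<br)
    ... | row-i     | row-i     = ⊥-elim (<-irrefl refl r<s)
    ... | row-i     | row-suc-i = ⊥-elim (<-asym m<ai (subst₂ _<_ (swap-at-suc-i i a) (swap-at-i i a) bs<br))
    ... | row-suc-i | row-i     = ⊥-elim (<-asym r<s (n<1+n i))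
    ... | row-suc-i | row-suc-i = ⊥-elim (<-irrefl refl r<s)
    ... | row-i | empty-row _ s≢i+1 bs≡0 as≡0 with refl ← basement-column bs≡0 c≤bs = λ cv →
      let 1≤m = subst (_ ≤_) (swap-at-i i a) c<br
          (i<v , v≤s) = coinv⇒between r<s cv
          i+1<v = ≤∧≢⇒< i<v (E-diagonal-differ 0 1≤m)
      in entry-not-between (above-rows r<s s≢i+1) s≤n as≡0 (E-row-i-entry 1 1≤m) (i+1<v , v≤s)
    ... | row-suc-i | empty-row _ _ bs≡0 as≡0 with refl ← basement-column bs≡0 c≤bs = λ cv →
      entry-not-between r<s s≤n as≡0 (E-row-suc-i-entry 1 (subst (_ ≤_) (swap-at-suc-i i a) c<br))
                        (coinv⇒between r<s cv)

    E-no-typeII : ∀ r s c → TypeII n b r s c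
                  → ¬ CoInv (val E r c , c) (val E r (suc c) , suc c) (val E s (suc c) , suc c)
    E-no-typeII r s c ((1≤r , r≤n , _) , (_ , _ , c<br) , (1≤s , s≤n , c<bs) , s<r , _)
      with rowOf r 1≤r r≤n | rowOf s 1≤s s≤n
    ... | empty-row _ _ br≡0 _ | _                    = ⊥-elim (no-cell br≡0 c<br)
    ... | _                    | empty-row _ _ bs≡0 _ = ⊥-elim (no-cell bs≡0 c<bs)
    ... | row-i     | row-i     = ⊥-elim (<-irrefl refl s<r)
    ... | row-i     | row-suc-i = ⊥-elim (<-asym s<r (n<1+n i))
    ... | row-suc-i | row-suc-i = ⊥-elim (<-irrefl refl s<r)
    ... | row-suc-i | row-i     =
      let c<m = subst (_ ≤_) (swap-at-i i a) c<bs
      in ¬coinv-cong (E-upper c (<⇒≤ c<m)) (E-upper (suc c) c<m) (E-lower (suc c) c<m)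
                     (¬coinv-upper-upper-lower c)

lemma4p2 : (n : ℕ) → 2 ≤ n → (i : ℕ) → 1 ≤ i → i < n → (a : Composition)
           → (∀ j → 1 ≤ j → j ≤ n → j ≢ i → j ≢ suc i → a j ≡ 0)
           → a (suc i) < a i
           → (T : Filling) → SSKD n a T → SSKD n (swap i a) (embed i a T)
lemma4p2 n _ i 1≤i i<n a others-empty m<ai T T-sskd =
  E-range , (E-column-distinct , E-adjacent-distinct) , E-no-typeI , E-no-typeII
  where open Embedding.Correctness i a T n 1≤i i<n others-empty m<ai T-sskd
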